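{- Let $G$ be a planar PCC graph and let $Z$ be the number of vertices $v$ of $G$ with $f(v)=(5,6,7)$ or $f(v)=(3,3,5,7)$. Then $Z\le 210$.
   Context: All graphs are finite, simple, connected, and 2-cell embedded in the sphere; the set of faces includes the outer face. For a face $\sigma$, $|\sigma|$ is the number of edges in its boundary walk, counted with multiplicity. For a vertex $v$, $F(v)$ is the multiset of faces incident to $v$ (one entry per corner), $K(v)=1-\frac{\deg(v)}{2}+\sum_{\sigma\in F(v)}\frac{1}{|\sigma|}$, and the face vector $f(v)$ is the multiset of sizes of faces in $F(v)$; $f(v)=(a_1,\dots,a_k)$ means this multiset equals $\{a_1,\dots,a_k\}$. A prism of order $N$: $2N$ vertices, two faces of size $N$, $N$ faces of size $4$, $f(v)=\{4,4,N\}$ for all $v$. An antiprism of order $N$: $2N$ vertices, two faces of size $N$, $2N$ faces of size $3$, $f(v)=\{3,3,3,N\}$ for all $v$. A planar PCC graph is such a graph with $K(v)>0$ and $\deg(v)\ge3$ for every vertex $v$, which is not a prism or an antiprism. -}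

module Defs where

open import Data.Nat using (ℕ; zero; suc; _+_; _*_; _≤_)
open import Data.Nat.Properties using (_≤?_)
open import Data.Fin using (Fin; toℕ)
open import Data.Fin.Properties using (any?; all?; _≟_)
open import Data.Fin.Permutation using (Permutation′; _⟨$⟩ʳ_)
open import Data.List using (List; []; _∷_; map; filter; length; replicate; foldr)
open import Data.List.Relation.Binary.Permutation.Propositional using (_↭_)
open import Data.List.Relation.Unary.All using (All)
open import Data.List.Relation.Unary.AllPairs using (AllPairs)
open import Data.List.Base using (allFin)
open import Data.Product using (Σ; ∃; _×_; _,_)
open import Data.Sum using (_⊎_)
open import Data.Integer using (+_)
open import Data.Rational using (ℚ; 0ℚ; 1ℚ) renaming (_+_ to _+ℚ_; _-_ to _-ℚ_; _/_ to _/ℚ_; _<_ to _<ℚ_)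
open import Relation.Nullary using (¬_; Dec; yes; no)
open import Relation.Unary using (Decidable)
open import Relation.Binary.PropositionalEquality using (_≡_; _≢_)

iter : ∀ {n} → (Fin n → Fin n) → ℕ → Fin n → Fin n
iter f zero    d = d
iter f (suc k) d = f (iter f k d)

-- e lies in the orbit of d under the permutation f (of a set of n elements,
-- so exponents k < n suffice).
InOrbit : ∀ {n} → (Fin n → Fin n) → Fin n → Fin n → Set
InOrbit {n} f d e = ∃ λ (k : Fin n) → iter f (toℕ k) d ≡ e

inOrbit? : ∀ {n} (f : Fin n → Fin n) (d : Fin n) → Decidable (InOrbit f d)
inOrbit? f d e = any? (λ k → iter f (toℕ k) d ≟ e)

count : ∀ {n} {P : Fin n → Set} → Decidable P → ℕ
count {n} P? = length (filter P? (allFin n))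

-- Combinatorial maps (rotation systems): a connected graph 2-cell embedded
-- in an oriented surface.  Darts = Fin n (two per edge), α = edge involution
-- (fixed-point free), σ = rotation at vertices.  Vertices = σ-orbits,
-- edges = α-orbits, faces = φ-orbits where φ = σ ∘ α.

data Reach {n} (σ α : Fin n → Fin n) : Fin n → Fin n → Set where
  here  : ∀ {d} → Reach σ α d d
  stepσ : ∀ {d e} → Reach σ α (σ d) e → Reach σ α d e
  stepα : ∀ {d e} → Reach σ α (α d) e → Reach σ α d e

record Map (n : ℕ) : Set where
  field
    σ′ α′ : Permutation′ n
  σ : Fin n → Fin n
  σ = σ′ ⟨$⟩ʳ_
  α : Fin n → Fin n
  α = α′ ⟨$⟩ʳ_
  φ : Fin n → Fin n
  φ d = σ (α d)
  field
    α-invol     : ∀ d → α (α d) ≡ d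
    α-fixfree   : ∀ d → α d ≢ d
    connected   : ∀ d e → Reach σ α d e

module _ {n : ℕ} (M : Map n) where
  open Map M

  SameVertex : Fin n → Fin n → Set
  SameVertex = InOrbit σ

  SameFace : Fin n → Fin n → Set
  SameFace = InOrbit φ

  IsVertexRep : Fin n → Set
  IsVertexRep d = ∀ e → SameVertex d e → toℕ d ≤ toℕ e

  isVertexRep? : Decidable IsVertexRep
  isVertexRep? d = all? (λ e → dec e)
    where
    dec : ∀ e → Dec (SameVertex d e → toℕ d ≤ toℕ e)
    dec e with inOrbit? σ d e | toℕ d ≤? toℕ e
    ... | _      | yes p = yes (λ _ → p)
    ... | no ¬s  | no _  = yes (λ s → Data.Empty.⊥-elim (¬s s))
      where import Data.Empty
    ... | yes s  | no ¬p = no (λ f → ¬p (f s))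

  IsFaceRep : Fin n → Set
  IsFaceRep d = ∀ e → SameFace d e → toℕ d ≤ toℕ e

  isFaceRep? : Decidable IsFaceRep
  isFaceRep? d = all? (λ e → dec e)
    where
    dec : ∀ e → Dec (SameFace d e → toℕ d ≤ toℕ e)
    dec e with inOrbit? φ d e | toℕ d ≤? toℕ e
    ... | _      | yes p = yes (λ _ → p)
    ... | no ¬s  | no _  = yes (λ s → Data.Empty.⊥-elim (¬s s))
      where import Data.Empty
    ... | yes s  | no ¬p = no (λ f → ¬p (f s))

  numVertices numEdges numFaces : ℕ
  numVertices = count isVertexRep?
  numFaces    = count isFaceRep?
  -- numEdges * 2 = n (α is a fixed-point-free involution)
  numEdges    = Data.Nat._/_ n 2
    where import Data.Nat

  -- Genus 0: Euler's formula V - E + F = 2, stated as 2V + 2F = n + 4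
  -- (n = 2E darts).
  IsSpherical : Set
  IsSpherical = 2 * (numVertices + numFaces) ≡ n + 4

  -- Simple graph: no loops and no multiple edges.
  IsSimple : Set
  IsSimple = (∀ d → ¬ SameVertex d (α d))
           × (∀ d e → SameVertex d e → SameVertex (α d) (α e) → d ≡ e)

  deg : Fin n → ℕ
  deg d = count (inOrbit? σ d)

  faceSize : Fin n → ℕ
  faceSize d = count (inOrbit? φ d)

  -- darts at the vertex of d; each corresponds to one corner at that vertex
  dartsAt : Fin n → List (Fin n)
  dartsAt d = filter (inOrbit? σ d) (allFin n)

  -- face vector f(v) of the vertex of dart d, as a list (read up to ↭)
  faceVector : Fin n → List ℕ
  faceVector d = map faceSize (dartsAt d)

  faceSizes : List ℕ
  faceSizes = map faceSize (filter isFaceRep? (allFin n))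

  -- 1/k as a rational (faces always have size ≥ 1; 0 for k = 0 unused)
  inv : ℕ → ℚ
  inv zero    = 0ℚ
  inv (suc k) = + 1 /ℚ suc k

  curvature : Fin n → ℚ
  curvature d = (1ℚ -ℚ (+ deg d /ℚ 2))
              +ℚ foldr (λ e acc → inv (faceSize e) +ℚ acc) 0ℚ (dartsAt d)

  IsPrism : Set
  IsPrism = Σ ℕ λ N → (numVertices ≡ 2 * N)
          × (faceSizes ↭ (N ∷ N ∷ replicate N 4))
          × (∀ d → faceVector d ↭ (4 ∷ 4 ∷ N ∷ []))

  IsAntiprism : Set
  IsAntiprism = Σ ℕ λ N → (numVertices ≡ 2 * N)
          × (faceSizes ↭ (N ∷ N ∷ replicate (2 * N) 3))
          × (∀ d → faceVector d ↭ (3 ∷ 3 ∷ 3 ∷ N ∷ []))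

record PlanarPCC {n : ℕ} (M : Map n) : Set where
  field
    spherical    : IsSpherical M
    simple       : IsSimple M
    curv-pos     : ∀ d → 0ℚ <ℚ curvature M d
    deg≥3        : ∀ d → 3 ≤ deg M d
    not-prism    : ¬ IsPrism M
    not-antiprism : ¬ IsAntiprism M

Special : ∀ {n} (M : Map n) → Fin n → Set
Special M d = (faceVector M d ↭ (5 ∷ 6 ∷ 7 ∷ []))
            ⊎ (faceVector M d ↭ (3 ∷ 3 ∷ 5 ∷ 7 ∷ []))

-- "Z ≤ k": any list of darts at pairwise distinct vertices, all special,
-- has length ≤ k (i.e. the number of special vertices is at most k).
SpecialVerticesAtMost : ∀ {n} (M : Map n) → ℕ → Set
SpecialVerticesAtMost {n} M k =
  (vs : List (Fin n)) → AllPairs (λ d e → ¬ SameVertex M d e) vs →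
  All (Special M) vs → length vs ≤ k

-- Every vertex of a planar PCC graph has positive curvature, and by the discrete Gauss–Bonnet
-- formula the curvatures of a map on the sphere add up to V − E + F = 2.  A vertex with face
-- vector (5,6,7) has curvature −1/2 + 1/5 + 1/6 + 1/7 = 1/105, one with face vector (3,3,5,7)
-- has −1 + 2/3 + 1/5 + 1/7 = 1/105, so there are at most 2 · 105 = 210 of them.
module Submission where

open import Defs
open import Data.Nat as ℕ using (ℕ; zero; suc)
import Data.Nat.Properties as ℕₚ
open import Data.Nat.DivMod using (_%_; m%n<n; m≡m%n+[m/n]*n) renaming (_/_ to _div_)
open import Data.Integer as ℤ using (+_)
import Data.Integer.Properties as ℤₚ
open import Data.Rational
open import Data.Rational.Properties
import Data.Rational.Unnormalised as ℚᵘ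
import Data.Rational.Unnormalised.Properties as ℚᵘₚ
open import Data.Rational.Solver using (module +-*-Solver)
open import Data.Fin using (Fin; toℕ; fromℕ<)
import Data.Fin.Properties as Finₚ
open import Data.Fin.Permutation using (_⟨$⟩ʳ_; _⟨$⟩ˡ_; inverseˡ)
open import Data.List using (List; []; _∷_; filter; length; map; foldr)
open import Data.List.Base using (allFin)
open import Data.List.Properties using (filter-≐; filter-some; length-map; length-tabulate)
open import Data.List.Relation.Unary.All as All using (All; []; _∷_)
open import Data.List.Relation.Unary.All.Properties using (all-filter; filter⁺)
open import Data.List.Relation.Unary.Any as Any using (Any; here; there)
open import Data.List.Relation.Unary.AllPairs as AllPairs using (AllPairs; []; _∷_)
open import Data.List.Relation.Binary.Permutation.Propositional using (_↭_; prep; swap)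
import Data.List.Relation.Binary.Permutation.Propositional as ↭
open import Data.List.Relation.Unary.Unique.Propositional.Properties using (allFin⁺)
open import Data.List.Relation.Binary.Permutation.Propositional.Properties using (↭-length)
open import Data.List.Membership.Propositional.Properties using (∈-allFin; ∈-filter⁺)
open import Data.Product using (∃; _×_; _,_)
open import Data.Sum using (inj₁; inj₂)
open import Data.Bool using (true; false; if_then_else_)
open import Data.Empty using (⊥)
open import Relation.Nullary using (Dec; does; yes; no; ¬_; contradiction)
open import Relation.Unary using (Pred; Decidable)
open import Relation.Nullary.Decidable using (_×-dec_)
open import Relation.Binary.PropositionalEquality
open import Algebra.Bundles using (CommutativeMonoid)
open import Algebra.Properties.CommutativeSemigroup
  (CommutativeMonoid.commutativeSemigroup +-0-commutativeMonoid) using (interchange)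
open import Algebra.Properties.CommutativeSemigroup
  (CommutativeMonoid.commutativeSemigroup *-1-commutativeMonoid) using (x∙yz≈y∙xz)
open import Function using (_∘_)
open import Level using (0ℓ)

fromℕ : ℕ → ℚ
fromℕ a = + a / 1

private
  toℚᵘ-/ : ∀ a k → toℚᵘ (+ a / suc k) ℚᵘ.≃ ℚᵘ.mkℚᵘ (+ a) k
  toℚᵘ-/ a k = toℚᵘ-fromℚᵘ (ℚᵘ.mkℚᵘ (+ a) k)

fromℕ-+ : ∀ a b → fromℕ (a ℕ.+ b) ≡ fromℕ a + fromℕ b
fromℕ-+ a b = toℚᵘ-injective (begin-equality
  toℚᵘ (fromℕ (a ℕ.+ b))              ≃⟨ toℚᵘ-/ (a ℕ.+ b) 0 ⟩
  ℚᵘ.mkℚᵘ (+ (a ℕ.+ b)) 0             ≃⟨ ℚᵘ.*≡* (sym eq) ⟩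
  ℚᵘ.mkℚᵘ (+ a) 0 ℚᵘ.+ ℚᵘ.mkℚᵘ (+ b) 0 ≃⟨ ℚᵘₚ.≃-sym (ℚᵘₚ.+-cong (toℚᵘ-/ a 0) (toℚᵘ-/ b 0)) ⟩
  toℚᵘ (fromℕ a) ℚᵘ.+ toℚᵘ (fromℕ b)   ≃⟨ ℚᵘₚ.≃-sym (toℚᵘ-homo-+ (fromℕ a) (fromℕ b)) ⟩
  toℚᵘ (fromℕ a + fromℕ b)             ∎)
  where
  open ℚᵘₚ.≤-Reasoning
  eq : (+ a ℤ.* + 1 ℤ.+ + b ℤ.* + 1) ℤ.* + 1 ≡ + (a ℕ.+ b) ℤ.* + 1
  eq rewrite ℤₚ.*-identityʳ (+ a) | ℤₚ.*-identityʳ (+ b) | ℤₚ.*-identityʳ (+ (a ℕ.+ b)) = refl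

fromℕ-* : ∀ a b → fromℕ (a ℕ.* b) ≡ fromℕ a * fromℕ b
fromℕ-* a b = toℚᵘ-injective (begin-equality
  toℚᵘ (fromℕ (a ℕ.* b))                ≃⟨ toℚᵘ-/ (a ℕ.* b) 0 ⟩
  ℚᵘ.mkℚᵘ (+ (a ℕ.* b)) 0               ≃⟨ ℚᵘ.*≡* (sym eq) ⟩
  ℚᵘ.mkℚᵘ (+ a) 0 ℚᵘ.* ℚᵘ.mkℚᵘ (+ b) 0   ≃⟨ ℚᵘₚ.≃-sym (ℚᵘₚ.*-cong (toℚᵘ-/ a 0) (toℚᵘ-/ b 0)) ⟩
  toℚᵘ (fromℕ a) ℚᵘ.* toℚᵘ (fromℕ b)     ≃⟨ ℚᵘₚ.≃-sym (toℚᵘ-homo-* (fromℕ a) (fromℕ b)) ⟩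
  toℚᵘ (fromℕ a * fromℕ b)               ∎)
  where
  open ℚᵘₚ.≤-Reasoning
  eq : (+ a ℤ.* + b) ℤ.* + 1 ≡ + (a ℕ.* b) ℤ.* + 1
  eq rewrite ℤₚ.*-identityʳ (+ a ℤ.* + b) | ℤₚ.*-identityʳ (+ (a ℕ.* b)) = sym (ℤₚ.pos-* a b)

fromℕ-*-1/ : ∀ a k → fromℕ a * (+ 1 / suc k) ≡ + a / suc k
fromℕ-*-1/ a k = toℚᵘ-injective (begin-equality
  toℚᵘ (fromℕ a * (+ 1 / suc k))           ≃⟨ toℚᵘ-homo-* (fromℕ a) (+ 1 / suc k) ⟩
  toℚᵘ (fromℕ a) ℚᵘ.* toℚᵘ (+ 1 / suc k)   ≃⟨ ℚᵘₚ.*-cong (toℚᵘ-/ a 0) (toℚᵘ-/ 1 k) ⟩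
  ℚᵘ.mkℚᵘ (+ a) 0 ℚᵘ.* ℚᵘ.mkℚᵘ (+ 1) k     ≃⟨ ℚᵘ.*≡* eq ⟩
  ℚᵘ.mkℚᵘ (+ a) k                          ≃⟨ ℚᵘₚ.≃-sym (toℚᵘ-/ a k) ⟩
  toℚᵘ (+ a / suc k)                       ∎)
  where
  open ℚᵘₚ.≤-Reasoning
  eq : (+ a ℤ.* + 1) ℤ.* + suc k ≡ + a ℤ.* + (1 ℕ.* suc k)
  eq rewrite ℤₚ.*-identityʳ (+ a) | ℕₚ.*-identityˡ (suc k) = refl

fromℕ-*-1/-cancel : ∀ k → fromℕ (suc k) * (+ 1 / suc k) ≡ 1ℚ
fromℕ-*-1/-cancel k = trans (fromℕ-*-1/ (suc k) k)
  (toℚᵘ-injective (ℚᵘₚ.≃-trans (toℚᵘ-/ (suc k) k) (ℚᵘ.*≡* (ℤₚ.*-comm (+ suc k) (+ 1)))))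

fromℕ-cancel-≤ : ∀ {a b} → fromℕ a ≤ fromℕ b → a ℕ.≤ b
fromℕ-cancel-≤ {a} {b} le = ℤₚ.drop‿+≤+ (subst₂ ℤ._≤_ (ℤₚ.*-identityʳ (+ a)) (ℤₚ.*-identityʳ (+ b))
  (ℚᵘₚ.drop-*≤* (ℚᵘₚ.≤-respʳ-≃ (toℚᵘ-/ b 0) (ℚᵘₚ.≤-respˡ-≃ (toℚᵘ-/ a 0) (toℚᵘ-mono-≤ le)))))

fromℕ-*-1/-≤ : ∀ m k c → fromℕ m * (+ 1 / suc k) ≤ fromℕ c → m ℕ.≤ c ℕ.* suc k
fromℕ-*-1/-≤ m k c le = fromℕ-cancel-≤ (begin
  fromℕ m                                          ≡⟨ *-identityʳ (fromℕ m) ⟨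
  fromℕ m * 1ℚ                                     ≡⟨ cong (fromℕ m *_) (trans (*-comm _ (fromℕ (suc k))) (fromℕ-*-1/-cancel k)) ⟨
  fromℕ m * ((+ 1 / suc k) * fromℕ (suc k))        ≡⟨ *-assoc (fromℕ m) _ _ ⟨
  fromℕ m * (+ 1 / suc k) * fromℕ (suc k)          ≤⟨ *-monoʳ-≤-nonNeg (fromℕ (suc k)) {{normalize-nonNeg (suc k) 1}} le ⟩
  fromℕ c * fromℕ (suc k)                          ≡⟨ fromℕ-* c (suc k) ⟨
  fromℕ (c ℕ.* suc k)                              ∎)
  where open ≤-Reasoning

indicator : ∀ {P : Set} → Dec P → ℚ → ℚ
indicator P? c = if does P? then c else 0ℚ

∑ : ∀ {A : Set} → List A → (A → ℚ) → ℚ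
∑ L g = foldr (λ x acc → g x + acc) 0ℚ L

module _ {A : Set} where

  ∑-cong : ∀ L {g h : A → ℚ} → (∀ x → g x ≡ h x) → ∑ L g ≡ ∑ L h
  ∑-cong []      g≗h = refl
  ∑-cong (x ∷ L) g≗h = cong₂ _+_ (g≗h x) (∑-cong L g≗h)

  ∑-cong-All : ∀ {L} {g h : A → ℚ} → All (λ x → g x ≡ h x) L → ∑ L g ≡ ∑ L h
  ∑-cong-All []            = refl
  ∑-cong-All (gx≡hx ∷ eqs) = cong₂ _+_ gx≡hx (∑-cong-All eqs)

  ∑-mono-≤ : ∀ L {g h : A → ℚ} → (∀ x → g x ≤ h x) → ∑ L g ≤ ∑ L h
  ∑-mono-≤ []      g≤h = ≤-refl
  ∑-mono-≤ (x ∷ L) g≤h = +-mono-≤ (g≤h x) (∑-mono-≤ L g≤h)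

  ∑-+ : ∀ L (g h : A → ℚ) → ∑ L (λ x → g x + h x) ≡ ∑ L g + ∑ L h
  ∑-+ []      g h = sym (+-identityˡ 0ℚ)
  ∑-+ (x ∷ L) g h = trans (cong (_+_ (g x + h x)) (∑-+ L g h)) (interchange (g x) (h x) (∑ L g) (∑ L h))

  ∑-neg : ∀ L (g : A → ℚ) → ∑ L (λ x → - g x) ≡ - ∑ L g
  ∑-neg []      g = refl
  ∑-neg (x ∷ L) g = trans (cong (_+_ (- g x)) (∑-neg L g)) (sym (neg-distrib-+ (g x) (∑ L g)))

  ∑-*ʳ : ∀ L (g : A → ℚ) c → ∑ L (λ x → g x * c) ≡ ∑ L g * c
  ∑-*ʳ []      g c = sym (*-zeroˡ c)
  ∑-*ʳ (x ∷ L) g c = trans (cong (_+_ (g x * c)) (∑-*ʳ L g c)) (sym (*-distribʳ-+ c (g x) (∑ L g)))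

  ∑-const : ∀ L c → ∑ L (λ (_ : A) → c) ≡ fromℕ (length L) * c
  ∑-const []      c = sym (*-zeroˡ c)
  ∑-const (x ∷ L) c = begin
    c + ∑ L (λ _ → c)                  ≡⟨ cong₂ _+_ (sym (*-identityˡ c)) (∑-const L c) ⟩
    1ℚ * c + fromℕ (length L) * c      ≡⟨ *-distribʳ-+ c 1ℚ (fromℕ (length L)) ⟨
    (1ℚ + fromℕ (length L)) * c        ≡⟨ cong (_* c) (fromℕ-+ 1 (length L)) ⟨
    fromℕ (suc (length L)) * c         ∎
    where open ≡-Reasoning

  ∑-map : ∀ {B : Set} (f : A → B) L (g : B → ℚ) → ∑ (map f L) g ≡ ∑ L (g ∘ f)
  ∑-map f []      g = refl
  ∑-map f (x ∷ L) g = cong (_+_ (g (f x))) (∑-map f L g)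

  ∑-↭ : ∀ {L L′} (g : A → ℚ) → L ↭ L′ → ∑ L g ≡ ∑ L′ g
  ∑-↭ g ↭.refl          = refl
  ∑-↭ g (prep x L↭L′)   = cong (_+_ (g x)) (∑-↭ g L↭L′)
  ∑-↭ g (swap x y L↭L′) = begin
    g x + (g y + _)  ≡⟨ +-assoc (g x) (g y) _ ⟨
    g x + g y + _    ≡⟨ cong₂ _+_ (+-comm (g x) (g y)) (∑-↭ g L↭L′) ⟩
    g y + g x + _    ≡⟨ +-assoc (g y) (g x) _ ⟩
    g y + (g x + _)  ∎
    where open ≡-Reasoning
  ∑-↭ g (↭.trans L↭L′ L′↭L″) = trans (∑-↭ g L↭L′) (∑-↭ g L′↭L″)

  ∑-filter : ∀ {P : Pred A 0ℓ} (P? : Decidable P) L (g : A → ℚ) →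
             ∑ (filter P? L) g ≡ ∑ L (λ x → indicator (P? x) (g x))
  ∑-filter P? []      g = refl
  ∑-filter P? (x ∷ L) g with does (P? x)
  ... | true  = cong (_+_ (g x)) (∑-filter P? L g)
  ... | false = trans (∑-filter P? L g) (sym (+-identityˡ _))

  module _ {Q : Pred A 0ℓ} (Q? : Decidable Q) (c : ℚ) where

    ∑-indicator-none : ∀ {L} → All (¬_ ∘ Q) L → ∑ L (λ x → indicator (Q? x) c) ≡ 0ℚ
    ∑-indicator-none {[]}    []         = refl
    ∑-indicator-none {x ∷ L} (¬Qx ∷ ¬Q) with Q? x
    ... | yes Qx = contradiction Qx ¬Qx
    ... | no  _  = trans (+-identityˡ _) (∑-indicator-none ¬Q)

    ∑-indicator-≤ : 0ℚ ≤ c → ∀ {L} → AllPairs (λ x y → Q x → Q y → ⊥) L →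
                    ∑ L (λ x → indicator (Q? x) c) ≤ c
    ∑-indicator-≤ 0≤c {[]}    []         = 0≤c
    ∑-indicator-≤ 0≤c {x ∷ L} (Qx⊥ ∷ Q⊥) with Q? x
    ... | yes Qx = ≤-reflexive (trans (cong (_+_ c) (∑-indicator-none (All.map (λ Qy⊥ → Qy⊥ Qx) Qx⊥))) (+-identityʳ c))
    ... | no  _  = ≤-trans (≤-reflexive (+-identityˡ _)) (∑-indicator-≤ 0≤c Q⊥)

    ∑-indicator-≡ : ∀ {L} → AllPairs (λ x y → Q x → Q y → ⊥) L → Any Q L →
                    ∑ L (λ x → indicator (Q? x) c) ≡ c
    ∑-indicator-≡ {x ∷ L} (Qx⊥ ∷ Q⊥) ∃Q with Q? x | ∃Q
    ... | yes Qx | _          = trans (cong (_+_ c) (∑-indicator-none (All.map (λ Qy⊥ → Qy⊥ Qx) Qx⊥))) (+-identityʳ c)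
    ... | no ¬Qx | here Qx    = contradiction Qx ¬Qx
    ... | no  _  | there ∃Q′  = trans (+-identityˡ _) (∑-indicator-≡ Q⊥ ∃Q′)

∑-swap : ∀ {A B : Set} (L : List A) (L′ : List B) (f : A → B → ℚ) →
         ∑ L (λ x → ∑ L′ (f x)) ≡ ∑ L′ (λ y → ∑ L (λ x → f x y))
∑-swap []      L′ f = sym (trans (∑-const L′ 0ℚ) (*-zeroʳ (fromℕ (length L′))))
∑-swap (x ∷ L) L′ f = trans (cong (_+_ (∑ L′ (f x))) (∑-swap L L′ f)) (sym (∑-+ L′ (f x) _))

module Orbit {n : ℕ} (f f⁻¹ : Fin n → Fin n) (f⁻¹∘f : ∀ x → f⁻¹ (f x) ≡ x) where

  iter-injective : ∀ k {x y} → iter f k x ≡ iter f k y → x ≡ y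
  iter-injective zero    eq = eq
  iter-injective (suc k) eq = iter-injective k (trans (sym (f⁻¹∘f _)) (trans (cong f⁻¹ eq) (f⁻¹∘f _)))

  iter-+ : ∀ a b x → iter f (a ℕ.+ b) x ≡ iter f a (iter f b x)
  iter-+ zero    b x = refl
  iter-+ (suc a) b x = cong f (iter-+ a b x)

  iter-comm : ∀ a b x → iter f a (iter f b x) ≡ iter f b (iter f a x)
  iter-comm a b x = trans (sym (iter-+ a b x)) (trans (cong (λ k → iter f k x) (ℕₚ.+-comm a b)) (iter-+ b a x))

  iter-*-period : ∀ {x p} → iter f p x ≡ x → ∀ q → iter f (q ℕ.* p) x ≡ x
  iter-*-period         f^px≡x zero    = refl
  iter-*-period {x} {p} f^px≡x (suc q) = trans (iter-+ p (q ℕ.* p) x) (trans (cong (iter f p) (iter-*-period f^px≡x q)) f^px≡x)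

  -- By pigeonhole two of x, f x, …, fⁿ x coincide, and f is injective.
  period : ∀ x → ∃ λ p → 0 ℕ.< p × p ℕ.≤ n × iter f p x ≡ x
  period x with Finₚ.pigeonhole (ℕₚ.n<1+n n) (λ (i : Fin (suc n)) → iter f (toℕ i) x)
  ... | i , j , i<j , fⁱx≡fʲx =
    toℕ j ℕ.∸ toℕ i , ℕₚ.m<n⇒0<n∸m i<j ,
    ℕₚ.≤-trans (ℕₚ.m∸n≤m (toℕ j) (toℕ i)) (ℕₚ.<⇒≤pred (Finₚ.toℕ<n j)) ,
    sym (iter-injective (toℕ i) (begin
      iter f (toℕ i) x                                 ≡⟨ fⁱx≡fʲx ⟩
      iter f (toℕ j) x                                 ≡⟨ cong (λ k → iter f k x) (ℕₚ.m∸n+n≡m (ℕₚ.<⇒≤ i<j)) ⟨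
      iter f (toℕ j ℕ.∸ toℕ i ℕ.+ toℕ i) x             ≡⟨ iter-+ (toℕ j ℕ.∸ toℕ i) (toℕ i) x ⟩
      iter f (toℕ j ℕ.∸ toℕ i) (iter f (toℕ i) x)      ≡⟨ iter-comm (toℕ j ℕ.∸ toℕ i) (toℕ i) x ⟩
      iter f (toℕ i) (iter f (toℕ j ℕ.∸ toℕ i) x)      ∎))
    where open ≡-Reasoning

  -- The exponent can be reduced modulo a period p ≤ n.
  iter⇒InOrbit : ∀ k {x y} → iter f k x ≡ y → InOrbit f x y
  iter⇒InOrbit k {x} fᵏx≡y with period x
  ... | p@(suc _) , _ , p≤n , fᵖx≡x =
    fromℕ< r<n , trans (cong (λ i → iter f i x) (Finₚ.toℕ-fromℕ< r<n)) (trans (sym k≡r) fᵏx≡y)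
    where
    open ≡-Reasoning
    r<n : k % p ℕ.< n
    r<n = ℕₚ.<-≤-trans (m%n<n k p) p≤n
    k≡r : iter f k x ≡ iter f (k % p) x
    k≡r = begin
      iter f k x                                    ≡⟨ cong (λ i → iter f i x) (m≡m%n+[m/n]*n k p) ⟩
      iter f (k % p ℕ.+ k div p ℕ.* p) x            ≡⟨ iter-+ (k % p) (k div p ℕ.* p) x ⟩
      iter f (k % p) (iter f (k div p ℕ.* p) x)     ≡⟨ cong (iter f (k % p)) (iter-*-period fᵖx≡x (k div p)) ⟩
      iter f (k % p) x                              ∎

  InOrbit-refl : ∀ x → InOrbit f x x
  InOrbit-refl x = iter⇒InOrbit 0 refl

  InOrbit-trans : ∀ {x y z} → InOrbit f x y → InOrbit f y z → InOrbit f x z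
  InOrbit-trans {x} (k , fᵏx≡y) (l , fˡy≡z) =
    iter⇒InOrbit (toℕ l ℕ.+ toℕ k) (trans (iter-+ (toℕ l) (toℕ k) x) (trans (cong (iter f (toℕ l)) fᵏx≡y) fˡy≡z))

  -- If y = fᵏ x and 1 + p is a period of x, then x = f^(pk) y.
  InOrbit-sym : ∀ {x y} → InOrbit f x y → InOrbit f y x
  InOrbit-sym {x} {y} (k′ , fᵏx≡y) with period x
  ... | suc p , _ , _ , fᵖx≡x = iter⇒InOrbit (p ℕ.* k) (begin
    iter f (p ℕ.* k) y                 ≡⟨ cong (iter f (p ℕ.* k)) fᵏx≡y ⟨
    iter f (p ℕ.* k) (iter f k x)      ≡⟨ iter-+ (p ℕ.* k) k x ⟨
    iter f (p ℕ.* k ℕ.+ k) x           ≡⟨ cong (λ i → iter f i x) (ℕₚ.+-comm (p ℕ.* k) k) ⟩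
    iter f (suc p ℕ.* k) x             ≡⟨ cong (λ i → iter f i x) (ℕₚ.*-comm (suc p) k) ⟩
    iter f (k ℕ.* suc p) x             ≡⟨ iter-*-period fᵖx≡x k ⟩
    x                                  ∎)
    where
    open ≡-Reasoning
    k = toℕ k′

  orbit : Fin n → List (Fin n)
  orbit x = filter (inOrbit? f x) (allFin n)

  orbit-≡ : ∀ {x y} → InOrbit f x y → orbit y ≡ orbit x
  orbit-≡ x∼y = filter-≐ (inOrbit? f _) (inOrbit? f _)
    (InOrbit-trans x∼y , InOrbit-trans (InOrbit-sym x∼y)) (allFin n)

  orbit-nonempty : ∀ x → 0 ℕ.< length (orbit x)
  orbit-nonempty x = filter-some (inOrbit? f x) (Any.map (λ { refl → InOrbit-refl x }) (∈-allFin x))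

  ∑-orbit-const : ∀ (g : List (Fin n) → ℚ) x → ∑ (orbit x) (g ∘ orbit) ≡ fromℕ (length (orbit x)) * g (orbit x)
  ∑-orbit-const g x = trans
    (∑-cong-All (All.map (λ x∼y → cong g (orbit-≡ x∼y)) (all-filter (inOrbit? f x) (allFin n))))
    (∑-const (orbit x) (g (orbit x)))

  ∑-orbits-swap : ∀ L (h : Fin n → ℚ) →
    ∑ L (λ r → ∑ (orbit r) h) ≡ ∑ (allFin n) (λ x → ∑ L (λ r → indicator (inOrbit? f r x) (h x)))
  ∑-orbits-swap L h = trans (∑-cong L (λ r → ∑-filter (inOrbit? f r) (allFin n) h))
    (∑-swap L (allFin n) (λ r x → indicator (inOrbit? f r x) (h x)))

  module _ {L : List (Fin n)} (disjoint : AllPairs (λ r s → ¬ InOrbit f r s) L) where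

    private
      meet-at-most-once : ∀ x → AllPairs (λ r s → InOrbit f r x → InOrbit f s x → ⊥) L
      meet-at-most-once x = AllPairs.map (λ r≁s r∼x s∼x → r≁s (InOrbit-trans r∼x (InOrbit-sym s∼x))) disjoint

    ∑-orbits-≤ : ∀ (h : Fin n → ℚ) → (∀ x → 0ℚ ≤ h x) → ∑ L (λ r → ∑ (orbit r) h) ≤ ∑ (allFin n) h
    ∑-orbits-≤ h h≥0 = ≤-trans (≤-reflexive (∑-orbits-swap L h))
      (∑-mono-≤ (allFin n) (λ x → ∑-indicator-≤ (λ r → inOrbit? f r x) (h x) (h≥0 x) (meet-at-most-once x)))

    ∑-orbits-≡ : (∀ x → Any (λ r → InOrbit f r x) L) →
                 ∀ (h : Fin n → ℚ) → ∑ L (λ r → ∑ (orbit r) h) ≡ ∑ (allFin n) h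
    ∑-orbits-≡ cover h = trans (∑-orbits-swap L h)
      (∑-cong (allFin n) (λ x → ∑-indicator-≡ (λ r → inOrbit? f r x) (h x) (meet-at-most-once x) (cover x)))

  IsRep : Fin n → Set
  IsRep x = ∀ y → InOrbit f x y → toℕ x ℕ.≤ toℕ y

  rep-unique : ∀ {r s} → IsRep r → IsRep s → InOrbit f r s → r ≡ s
  rep-unique {r} {s} rep-r rep-s r∼s = Finₚ.toℕ-injective (ℕₚ.≤-antisym (rep-r s r∼s) (rep-s r (InOrbit-sym r∼s)))

  -- Descend to a smaller element of the orbit while there is one; toℕ x bounds the number of steps.
  rep-exists : ∀ x → ∃ λ r → IsRep r × InOrbit f r x
  rep-exists x = descend n x (Finₚ.toℕ<n x)
    where
    descend : ∀ fuel x → toℕ x ℕ.< fuel → ∃ λ r → IsRep r × InOrbit f r x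
    descend (suc fuel) x x<fuel with Finₚ.any? (λ y → inOrbit? f x y ×-dec (toℕ y ℕₚ.<? toℕ x))
    ... | yes (y , x∼y , y<x) =
      let r , rep-r , r∼y = descend fuel y (ℕₚ.≤-trans y<x (ℕₚ.<⇒≤pred x<fuel))
      in  r , rep-r , InOrbit-trans r∼y (InOrbit-sym x∼y)
    ... | no ∄smaller = x , (λ y x∼y → ℕₚ.≮⇒≥ (λ y<x → ∄smaller (y , x∼y , y<x))) , InOrbit-refl x

  module Representatives (rep? : Decidable IsRep) where

    reps : List (Fin n)
    reps = filter rep? (allFin n)

    reps-disjoint : AllPairs (λ r s → ¬ InOrbit f r s) reps
    reps-disjoint = filter-reps-disjoint (allFin⁺ n)
      where
      filter-reps-disjoint : ∀ {L} → AllPairs _≢_ L → AllPairs (λ r s → ¬ InOrbit f r s) (filter rep? L)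
      filter-reps-disjoint {[]}    []        = []
      filter-reps-disjoint {x ∷ L} (x≢ ∷ ≢) with rep? x
      ... | yes rep-x = All.zipWith (λ (x≢s , rep-s) x∼s → x≢s (rep-unique rep-x rep-s x∼s))
                          (filter⁺ rep? x≢ , all-filter rep? L) ∷ filter-reps-disjoint ≢
      ... | no  _     = filter-reps-disjoint ≢

    reps-cover : ∀ x → Any (λ r → InOrbit f r x) reps
    reps-cover x with rep-exists x
    ... | r , rep-r , r∼x = Any.map (λ { refl → r∼x }) (∈-filter⁺ rep? (∈-allFin r) rep-r)

    ∑-by-orbits : ∀ (h : Fin n → ℚ) → ∑ reps (λ r → ∑ (orbit r) h) ≡ ∑ (allFin n) h
    ∑-by-orbits = ∑-orbits-≡ reps-disjoint reps-cover

euler-ℚ : ∀ V F E → 2 ℕ.* (V ℕ.+ F) ≡ E ℕ.+ 4 → fromℕ V - fromℕ E * ½ + fromℕ F ≡ fromℕ 2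
euler-ℚ V F E χ = begin
  fromℕ V - fromℕ E * ½ + fromℕ F
    ≡⟨ solve 3 (λ x y z → (x :- (y :* con ½)) :+ z
                      := ((((x :+ z) :+ (x :+ z)) :* con ½) :- ((y :+ con (fromℕ 4)) :* con ½)) :+ con (fromℕ 2))
               refl (fromℕ V) (fromℕ E) (fromℕ F) ⟩
  (v+f + v+f) * ½ - (fromℕ E + fromℕ 4) * ½ + fromℕ 2
    ≡⟨ cong (λ t → t * ½ - (fromℕ E + fromℕ 4) * ½ + fromℕ 2) twice ⟩
  (fromℕ E + fromℕ 4) * ½ - (fromℕ E + fromℕ 4) * ½ + fromℕ 2
    ≡⟨ cong (_+ fromℕ 2) (+-inverseʳ ((fromℕ E + fromℕ 4) * ½)) ⟩
  0ℚ + fromℕ 2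
    ≡⟨ +-identityˡ (fromℕ 2) ⟩
  fromℕ 2 ∎
  where
  open ≡-Reasoning
  open +-*-Solver
  v+f = fromℕ V + fromℕ F
  twice : v+f + v+f ≡ fromℕ E + fromℕ 4
  twice = begin
    v+f + v+f                              ≡⟨ cong (λ t → t + t) (fromℕ-+ V F) ⟨
    fromℕ (V ℕ.+ F) + fromℕ (V ℕ.+ F)      ≡⟨ fromℕ-+ (V ℕ.+ F) (V ℕ.+ F) ⟨
    fromℕ (V ℕ.+ F ℕ.+ (V ℕ.+ F))          ≡⟨ cong fromℕ (trans (cong (V ℕ.+ F ℕ.+_) (sym (ℕₚ.+-identityʳ _))) χ) ⟩
    fromℕ (E ℕ.+ 4)                        ≡⟨ fromℕ-+ E 4 ⟩
    fromℕ E + fromℕ 4                      ∎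

module _ {n : ℕ} (M : Map n) where
  open Map M

  private
    module Vertices = Orbit σ (σ′ ⟨$⟩ˡ_) (λ _ → inverseˡ σ′)
    module Faces    = Orbit φ (α ∘ (σ′ ⟨$⟩ˡ_)) (λ x → trans (cong α (inverseˡ σ′)) (α-invol x))
    module VertexReps = Vertices.Representatives (isVertexRep? M)
    module FaceReps   = Faces.Representatives (isFaceRep? M)

  vertexReps : List (Fin n)
  vertexReps = VertexReps.reps

  fromℕ-*-inv : ∀ m → 0 ℕ.< m → fromℕ m * inv M m ≡ 1ℚ
  fromℕ-*-inv (suc k) _ = fromℕ-*-1/-cancel k

  inv-nonNeg : ∀ m → 0ℚ ≤ inv M m
  inv-nonNeg zero    = ≤-refl
  inv-nonNeg (suc k) = nonNegative⁻¹ _ {{normalize-nonNeg 1 (suc k)}}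

  -- Each face contributes 1/|face| at each of its |face| corners.
  ∑-inv-faceSize : ∑ (allFin n) (inv M ∘ faceSize M) ≡ fromℕ (numFaces M)
  ∑-inv-faceSize = begin
    ∑ (allFin n) (inv M ∘ faceSize M)                              ≡⟨ FaceReps.∑-by-orbits (inv M ∘ faceSize M) ⟨
    ∑ FaceReps.reps (λ r → ∑ (Faces.orbit r) (inv M ∘ faceSize M)) ≡⟨ ∑-cong FaceReps.reps one-per-face ⟩
    ∑ FaceReps.reps (λ _ → 1ℚ)                                     ≡⟨ ∑-const FaceReps.reps 1ℚ ⟩
    fromℕ (numFaces M) * 1ℚ                                         ≡⟨ *-identityʳ _ ⟩
    fromℕ (numFaces M)                                              ∎
    where
    open ≡-Reasoning
    one-per-face : ∀ r → ∑ (Faces.orbit r) (inv M ∘ faceSize M) ≡ 1ℚ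
    one-per-face r = trans (Faces.∑-orbit-const (inv M ∘ length) r)
                           (fromℕ-*-inv (faceSize M r) (Faces.orbit-nonempty r))

  ∑-deg : ∑ vertexReps (fromℕ ∘ deg M) ≡ fromℕ n
  ∑-deg = begin
    ∑ vertexReps (fromℕ ∘ deg M)                               ≡⟨ ∑-cong vertexReps deg-as-∑ ⟩
    ∑ vertexReps (λ r → ∑ (Vertices.orbit r) (λ _ → 1ℚ))       ≡⟨ VertexReps.∑-by-orbits (λ _ → 1ℚ) ⟩
    ∑ (allFin n) (λ _ → 1ℚ)                                    ≡⟨ ∑-const (allFin n) 1ℚ ⟩
    fromℕ (length (allFin n)) * 1ℚ                             ≡⟨ *-identityʳ _ ⟩
    fromℕ (length (allFin n))                                  ≡⟨ cong fromℕ (length-tabulate {n = n} (λ x → x)) ⟩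
    fromℕ n                                                    ∎
    where
    open ≡-Reasoning
    deg-as-∑ : ∀ r → fromℕ (deg M r) ≡ ∑ (Vertices.orbit r) (λ _ → 1ℚ)
    deg-as-∑ r = sym (trans (∑-const (Vertices.orbit r) 1ℚ) (*-identityʳ _))

  -- Discrete Gauss–Bonnet: the three parts of ∑ K(v) are V, −n/2 = −E and F.
  ∑-curvature : IsSpherical M → ∑ vertexReps (curvature M) ≡ fromℕ 2
  ∑-curvature spherical = begin
    ∑ vertexReps (curvature M)
      ≡⟨ ∑-+ vertexReps (λ r → 1ℚ - (+ deg M r / 2)) (λ r → ∑ (dartsAt M r) (inv M ∘ faceSize M)) ⟩
    ∑ vertexReps (λ r → 1ℚ - (+ deg M r / 2)) + ∑ vertexReps (λ r → ∑ (dartsAt M r) (inv M ∘ faceSize M))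
      ≡⟨ cong₂ _+_ (∑-+ vertexReps (λ _ → 1ℚ) (λ r → - (+ deg M r / 2)))
                   (trans (VertexReps.∑-by-orbits (inv M ∘ faceSize M)) ∑-inv-faceSize) ⟩
    ∑ vertexReps (λ _ → 1ℚ) + ∑ vertexReps (λ r → - (+ deg M r / 2)) + fromℕ (numFaces M)
      ≡⟨ cong (λ t → t + fromℕ (numFaces M))
              (cong₂ _+_ (trans (∑-const vertexReps 1ℚ) (*-identityʳ (fromℕ (numVertices M)))) ∑-half-deg) ⟩
    fromℕ (numVertices M) - fromℕ n * ½ + fromℕ (numFaces M)
      ≡⟨ euler-ℚ (numVertices M) (numFaces M) n spherical ⟩
    fromℕ 2 ∎
    where
    open ≡-Reasoning
    ∑-half-deg : ∑ vertexReps (λ r → - (+ deg M r / 2)) ≡ - (fromℕ n * ½)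
    ∑-half-deg = begin
      ∑ vertexReps (λ r → - (+ deg M r / 2))        ≡⟨ ∑-neg vertexReps (λ r → + deg M r / 2) ⟩
      - ∑ vertexReps (λ r → + deg M r / 2)          ≡⟨ cong -_ (∑-cong vertexReps (λ r → fromℕ-*-1/ (deg M r) 1)) ⟨
      - ∑ vertexReps (λ r → fromℕ (deg M r) * ½)    ≡⟨ cong -_ (∑-*ʳ vertexReps (fromℕ ∘ deg M) ½) ⟩
      - (∑ vertexReps (fromℕ ∘ deg M) * ½)          ≡⟨ cong (λ t → - (t * ½)) ∑-deg ⟩
      - (fromℕ n * ½)                               ∎

  -- Spreading K(v) evenly over the deg(v) darts at v turns a sum over vertices into one over darts.
  ∑-curvature-share : ∀ v → ∑ (dartsAt M v) (λ d → curvature M d * inv M (deg M d)) ≡ curvature M v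
  ∑-curvature-share v = begin
    ∑ (dartsAt M v) (λ d → curvature M d * inv M (deg M d)) ≡⟨ Vertices.∑-orbit-const (λ D → curvatureOfDarts D * inv M (length D)) v ⟩
    fromℕ (deg M v) * (curvature M v * inv M (deg M v))     ≡⟨ x∙yz≈y∙xz (fromℕ (deg M v)) (curvature M v) _ ⟩
    curvature M v * (fromℕ (deg M v) * inv M (deg M v))     ≡⟨ cong (curvature M v *_) (fromℕ-*-inv (deg M v) (Vertices.orbit-nonempty v)) ⟩
    curvature M v * 1ℚ                                      ≡⟨ *-identityʳ _ ⟩
    curvature M v                                           ∎
    where
    open ≡-Reasoning
    curvatureOfDarts : List (Fin n) → ℚ
    curvatureOfDarts D = (1ℚ - (+ length D / 2)) + ∑ D (inv M ∘ faceSize M)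

  ∑-curvature-≤ : (∀ d → 0ℚ ≤ curvature M d) → ∀ {vs} → AllPairs (λ d e → ¬ SameVertex M d e) vs →
                  ∑ vs (curvature M) ≤ ∑ vertexReps (curvature M)
  ∑-curvature-≤ K≥0 {vs} distinct = begin
    ∑ vs (curvature M)                          ≡⟨ ∑-cong vs ∑-curvature-share ⟨
    ∑ vs (λ v → ∑ (dartsAt M v) share)          ≤⟨ Vertices.∑-orbits-≤ distinct share share≥0 ⟩
    ∑ (allFin n) share                          ≡⟨ VertexReps.∑-by-orbits share ⟨
    ∑ vertexReps (λ r → ∑ (dartsAt M r) share)  ≡⟨ ∑-cong vertexReps ∑-curvature-share ⟩
    ∑ vertexReps (curvature M)                  ∎
    where
    open ≤-Reasoning
    share : Fin n → ℚ
    share d = curvature M d * inv M (deg M d)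
    share≥0 : ∀ d → 0ℚ ≤ share d
    share≥0 d = nonNegative⁻¹ _ {{nonNeg*nonNeg⇒nonNeg (curvature M d) {{nonNegative (K≥0 d)}}
                                                       (inv M (deg M d)) {{nonNegative (inv-nonNeg (deg M d))}}}}

  curvatureOf : List ℕ → ℚ
  curvatureOf L = (1ℚ - (+ length L / 2)) + ∑ L (inv M)

  curvature-faceVector : ∀ {d L} → faceVector M d ↭ L → curvature M d ≡ curvatureOf L
  curvature-faceVector {d} f↭L = cong₂ (λ k s → (1ℚ - (+ k / 2)) + s)
    (trans (sym (length-map (faceSize M) (dartsAt M d))) (↭-length f↭L))
    (trans (sym (∑-map (faceSize M) (dartsAt M d) (inv M))) (∑-↭ (inv M) f↭L))

  special-curvature : ∀ {d} → Special M d → curvature M d ≡ + 1 / 105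
  special-curvature (inj₁ f↭567)  = curvature-faceVector f↭567
  special-curvature (inj₂ f↭3357) = curvature-faceVector f↭3357

lemma15p1 : ∀ {n : ℕ} (M : Map n) → PlanarPCC M → SpecialVerticesAtMost M 210
lemma15p1 M pcc vs distinct special = fromℕ-*-1/-≤ (length vs) 104 2 (begin
  fromℕ (length vs) * (+ 1 / 105)   ≡⟨ ∑-const vs (+ 1 / 105) ⟨
  ∑ vs (λ _ → + 1 / 105)            ≡⟨ ∑-cong-All (All.map (special-curvature M) special) ⟨
  ∑ vs (curvature M)                ≤⟨ ∑-curvature-≤ M (λ d → <⇒≤ (curv-pos d)) distinct ⟩
  ∑ (vertexReps M) (curvature M)    ≡⟨ ∑-curvature M spherical ⟩
  fromℕ 2                           ∎)
  where
  open PlanarPCC pcc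
  open ≤-Reasoning
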